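{- Let $G$ be a graph, $H$ a graph and $v\in V(H)$. (i) If $H\in\mathbf{W}_2$, then $G(H,v)$ belongs to $\mathbf{W}_1$ (i.e., is well-covered). (ii) If $H\in\mathbf{W}_3$, then $G(H,v)$ belongs to $\mathbf{W}_2$.
   Context: Graphs are finite, simple, undirected, with non-empty vertex sets. An independent set is a set of pairwise non-adjacent vertices; a maximum independent set is one of largest size. For a positive integer $n$, a graph belongs to the class $\mathbf{W}_n$ if every $n$ pairwise disjoint independent sets are included, respectively, in $n$ pairwise disjoint maximum independent sets; $\mathbf{W}_1$ is exactly the class of well-covered graphs (all maximal independent sets have the same size). The $G$-concatenation $G(H,v)$ of $H$ on the vertex $v$ is the graph obtained from $G$ by taking, for each vertex $u$ of $G$, a separate copy of $H$ and identifying $u$ with the copy of $v$ in that copy of $H$. -}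

module Defs where

open import Data.Nat using (ℕ; zero; suc; _*_; _≤_; _<_)
open import Data.Fin using (Fin; remQuot)
open import Data.Fin.Subset using (Subset; _∈_; _⊆_; ∣_∣)
open import Data.Product using (_×_; _,_; proj₁; proj₂; Σ)
open import Data.Sum using (_⊎_; inj₁; inj₂)
open import Data.Empty using (⊥)
open import Relation.Nullary using (¬_)
open import Relation.Binary.PropositionalEquality using (_≡_; refl; sym)
open import Data.Nat.Properties using (*-monoʳ-<; *-mono-<)

record Graph : Set₁ where
  field
    order    : ℕ
    nonempty : 0 < order
    Adj      : Fin order → Fin order → Set
    symm     : ∀ {x y} → Adj x y → Adj y x
    irrefl   : ∀ {x} → ¬ Adj x x
open Graph public

module _ (G : Graph) where
  Independent : Subset (order G) → Set
  Independent S = ∀ x y → x ∈ S → y ∈ S → ¬ Adj G x y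

  MaximumIndependent : Subset (order G) → Set
  MaximumIndependent S =
    Independent S × (∀ T → Independent T → ∣ T ∣ ≤ ∣ S ∣)

Disjoint : ∀ {n} → Subset n → Subset n → Set
Disjoint S T = ∀ x → x ∈ S → x ∈ T → ⊥

W : ℕ → Graph → Set
W k G =
  (S : Fin k → Subset (order G)) →
  (∀ i → Independent G (S i)) →
  (∀ i j → ¬ i ≡ j → Disjoint (S i) (S j)) →
  Σ (Fin k → Subset (order G)) λ T →
    (∀ i → MaximumIndependent G (T i)) ×
    (∀ i → S i ⊆ T i) ×
    (∀ i j → ¬ i ≡ j → Disjoint (T i) (T j))

WellCovered : Graph → Set
WellCovered = W 1

-- Vertex set V(G) × V(H) (encoded in
-- Fin (order G * order H) via remQuot): the pair (u , x) is the vertex x of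
-- the copy of H attached at u, and (u , v) is identified with u itself.
module _ (G H : Graph) (v : Fin (order H)) where
  private
    N = order G * order H
    split : Fin N → Fin (order G) × Fin (order H)
    split = remQuot {order G} (order H)
    ConcAdj : Fin N → Fin N → Set
    ConcAdj p q with split p | split q
    ... | (u , x) | (u' , y) =
      (u ≡ u' × Adj H x y) ⊎ ((x ≡ v × y ≡ v) × Adj G u u')

    concSym : ∀ {p q} → ConcAdj p q → ConcAdj q p
    concSym {p} {q} a with split p | split q
    concSym {p} {q} (inj₁ (e , h)) | (u , x) | (u' , y) = inj₁ (sym e , symm H h)
    concSym {p} {q} (inj₂ ((e₁ , e₂) , g)) | (u , x) | (u' , y) = inj₂ ((e₂ , e₁) , symm G g)

    concIrr : ∀ {p} → ¬ ConcAdj p p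
    concIrr {p} a with split p
    concIrr {p} (inj₁ (_ , h)) | (u , x) = irrefl H h
    concIrr {p} (inj₂ (_ , g)) | (u , x) = irrefl G g

  concat : Graph
  concat = record
    { order    = N
    ; nonempty = *-mono-< (nonempty G) (nonempty H)
    ; Adj      = ConcAdj
    ; symm     = concSym
    ; irrefl   = concIrr
    }

module Submission where

-- A maximum independent set of G(H,v) meets each copy of H in an independent set of H, so
-- gluing maximum independent sets of the copies yields a maximum independent set as soon as
-- the result is independent, i.e. no two G-adjacent copies both contribute their vertex v.
-- Given k disjoint independent sets of G(H,v), extend their rows in each copy using W (k+1)
-- with an extra set {v}, or ∅ when v already lies in some row: then v lies in an extended
-- row only if it lay in the row itself, so a G-edge between two contributions of v would
-- already be an edge inside one of the given independent sets.

open import Defs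
open import Data.Bool using (true; false)
open import Data.Fin using (Fin; zero; suc; combine; remQuot)
open import Data.Fin.Properties using (remQuot-combine; combine-remQuot; suc-injective; any?; _≟_)
open import Data.Fin.Subset using (Subset; _∈_; _⊆_; ∣_∣; ⁅_⁆) renaming (⊥ to ∅)
open import Data.Fin.Subset.Properties using (x∈⁅x⁆; x∈⁅y⁆⇒x≡y; ∉⊥; _∈?_)
open import Data.Nat using (ℕ; zero; suc; _+_; _*_; _≤_; z≤n)
open import Data.Nat.Properties using (+-mono-≤)
open import Data.Product using (_×_; _,_; proj₁; proj₂; Σ; uncurry)
open import Data.Sum using (_⊎_; inj₁; inj₂)
open import Data.Vec as Vec using ([]; _∷_; _++_; lookup; tabulate; group)
open import Data.Vec.Properties using ([]=⇒lookup; lookup⇒[]=; lookup∘tabulate; tabulate∘lookup; lookup-concat)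
open import Data.Vec.Functional as Vector using (Vector)
open import Data.Empty using (⊥; ⊥-elim)
open import Function using (id; _∘_)
open import Relation.Nullary using (¬_; yes; no)
open import Relation.Binary.PropositionalEquality using (_≡_; refl; sym; trans; cong; cong₂; subst; subst₂)

∣p++q∣≡∣p∣+∣q∣ : ∀ {m n} (p : Subset m) (q : Subset n) → ∣ p ++ q ∣ ≡ ∣ p ∣ + ∣ q ∣
∣p++q∣≡∣p∣+∣q∣ []          q = refl
∣p++q∣≡∣p∣+∣q∣ (true ∷ p)  q = cong suc (∣p++q∣≡∣p∣+∣q∣ p q)
∣p++q∣≡∣p∣+∣q∣ (false ∷ p) q = ∣p++q∣≡∣p∣+∣q∣ p q

∣concat∣-mono : ∀ {m n} (R R′ : Vector (Subset n) m) → (∀ u → ∣ R u ∣ ≤ ∣ R′ u ∣) →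
  ∣ Vec.concat (tabulate R) ∣ ≤ ∣ Vec.concat (tabulate R′) ∣
∣concat∣-mono {zero}  R R′ le = z≤n
∣concat∣-mono {suc m} R R′ le =
  subst₂ _≤_ (sym (∣p++q∣≡∣p∣+∣q∣ (R zero) _)) (sym (∣p++q∣≡∣p∣+∣q∣ (R′ zero) _))
    (+-mono-≤ (le zero) (∣concat∣-mono (R ∘ suc) (R′ ∘ suc) (le ∘ suc)))

-- Subsets of Fin m × Fin n, encoded in Fin (m * n) through combine, as families of rows.
module Rows (m n : ℕ) where

  glue : Vector (Subset n) m → Subset (m * n)
  glue R = Vec.concat (tabulate R)

  rows : Subset (m * n) → Vector (Subset n) m
  rows X = lookup (proj₁ (group m n X))

  glue-rows : ∀ X → glue (rows X) ≡ X
  glue-rows X =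
    trans (cong Vec.concat (tabulate∘lookup (proj₁ (group m n X)))) (sym (proj₂ (group m n X)))

  lookup-glue : ∀ R u x → lookup (glue R) (combine u x) ≡ lookup (R u) x
  lookup-glue R u x =
    trans (lookup-concat (tabulate R) u x) (cong (λ r → lookup r x) (lookup∘tabulate R u))

  ∈-glue⁺ : ∀ R {u x} → x ∈ R u → combine u x ∈ glue R
  ∈-glue⁺ R {u} {x} x∈Ru = lookup⇒[]= _ (glue R) (trans (lookup-glue R u x) ([]=⇒lookup x∈Ru))

  ∈-glue⁻ : ∀ R {u x} → combine u x ∈ glue R → x ∈ R u
  ∈-glue⁻ R {u} {x} ux∈R = lookup⇒[]= x (R u) (trans (sym (lookup-glue R u x)) ([]=⇒lookup ux∈R))

  ∈-rows⁺ : ∀ X {u x} → combine u x ∈ X → x ∈ rows X u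
  ∈-rows⁺ X ux∈X = ∈-glue⁻ (rows X) (subst (_ ∈_) (sym (glue-rows X)) ux∈X)

  ∈-rows⁻ : ∀ X {u x} → x ∈ rows X u → combine u x ∈ X
  ∈-rows⁻ X x∈Xu = subst (_ ∈_) (glue-rows X) (∈-glue⁺ (rows X) x∈Xu)

  ∀-combine : ∀ {P : Fin (m * n) → Set} →
    (∀ (u : Fin m) (x : Fin n) → P (combine u x)) → ∀ p → P p
  ∀-combine {P} h p = subst P (combine-remQuot {m} n p) (uncurry h (remQuot n p))

PairwiseDisjoint : ∀ {n k} → Vector (Subset n) k → Set
PairwiseDisjoint S = ∀ i j → ¬ i ≡ j → Disjoint (S i) (S j)

record MaximumExtension (G : Graph) {k : ℕ} (S : Vector (Subset (order G)) k) : Set where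
  field
    sets     : Vector (Subset (order G)) k
    maximum  : ∀ i → MaximumIndependent G (sets i)
    extends  : ∀ i → S i ⊆ sets i
    disjoint : PairwiseDisjoint sets

module _ (H : Graph) {k : ℕ} (w : W (suc k) H) (S : Vector (Subset (order H)) k)
         (indS : ∀ i → Independent H (S i)) (dsjS : PairwiseDisjoint S) where
  open MaximumExtension

  W-suc-extend-avoiding : ∀ Z → Independent H Z → (∀ i → Disjoint Z (S i)) →
    Σ (MaximumExtension H S) λ E → ∀ i → Disjoint (sets E i) Z
  W-suc-extend-avoiding Z indZ dsjZ with w (Z Vector.∷ S) indZS dsjZS
    where
      indZS : ∀ i → Independent H ((Z Vector.∷ S) i)
      indZS zero    = indZ
      indZS (suc i) = indS i
      dsjZS : PairwiseDisjoint (Z Vector.∷ S)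
      dsjZS zero    zero    0≢0 = ⊥-elim (0≢0 refl)
      dsjZS zero    (suc j) _   = dsjZ j
      dsjZS (suc i) zero    _   x x∈Si x∈Z = dsjZ i x x∈Z x∈Si
      dsjZS (suc i) (suc j) i≢j = dsjS i j (i≢j ∘ cong suc)
  ... | T , max , sub , dsj = record
    { sets     = T ∘ suc
    ; maximum  = max ∘ suc
    ; extends  = sub ∘ suc
    ; disjoint = λ i j i≢j → dsj (suc i) (suc j) (i≢j ∘ suc-injective)
    } , λ i x x∈Ti x∈Z → dsj (suc i) zero (λ ()) x x∈Ti (sub zero x∈Z)

  W-suc-extend-fixing : ∀ v → Σ (MaximumExtension H S) λ E → ∀ i → v ∈ sets E i → v ∈ S i
  W-suc-extend-fixing v with any? (λ j → v ∈? S j)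
  ... | yes (j , v∈Sj) = E , fixing
    where
      E = proj₁ (W-suc-extend-avoiding ∅ (λ _ _ x∈∅ → ⊥-elim (∉⊥ x∈∅)) (λ _ _ x∈∅ → ⊥-elim (∉⊥ x∈∅)))
      fixing : ∀ i → v ∈ sets E i → v ∈ S i
      fixing i v∈Ti with i ≟ j
      ... | yes refl = v∈Sj
      ... | no i≢j   = ⊥-elim (disjoint E i j i≢j v v∈Ti (extends E j v∈Sj))
  ... | no v∉S = E , λ i v∈Ti → ⊥-elim (avoids i v v∈Ti (x∈⁅x⁆ v))
    where
      indV : Independent H ⁅ v ⁆
      indV x y x∈V y∈V = irrefl H ∘ subst₂ (Adj H) (x∈⁅y⁆⇒x≡y v x∈V) (x∈⁅y⁆⇒x≡y v y∈V)
      dsjV : ∀ i → Disjoint ⁅ v ⁆ (S i)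
      dsjV i x x∈V x∈Si = v∉S (i , subst (_∈ S i) (x∈⁅y⁆⇒x≡y v x∈V) x∈Si)
      E = proj₁ (W-suc-extend-avoiding ⁅ v ⁆ indV dsjV)
      avoids = proj₂ (W-suc-extend-avoiding ⁅ v ⁆ indV dsjV)

module _ (G H : Graph) (v : Fin (order H)) where
  private
    C = concat G H v
  open Rows (order G) (order H)

  CopyAdj : Fin (order G) × Fin (order H) → Fin (order G) × Fin (order H) → Set
  CopyAdj (u , x) (u′ , y) = (u ≡ u′ × Adj H x y) ⊎ ((x ≡ v × y ≡ v) × Adj G u u′)

  Adj-combine : ∀ {u u′ x y} → Adj C (combine u x) (combine u′ y) ≡ CopyAdj (u , x) (u′ , y)
  Adj-combine {u} {u′} {x} {y} = cong₂ CopyAdj (remQuot-combine u x) (remQuot-combine u′ y)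

  Adj-combine⁺ : ∀ {u u′ x y} → CopyAdj (u , x) (u′ , y) → Adj C (combine u x) (combine u′ y)
  Adj-combine⁺ = subst id (sym Adj-combine)

  Adj-combine⁻ : ∀ {u u′ x y} → Adj C (combine u x) (combine u′ y) → CopyAdj (u , x) (u′ , y)
  Adj-combine⁻ = subst id Adj-combine

  rows-independent : ∀ X → Independent C X → ∀ u → Independent H (rows X u)
  rows-independent X indX u x y x∈Xu y∈Xu xy =
    indX _ _ (∈-rows⁻ X x∈Xu) (∈-rows⁻ X y∈Xu) (Adj-combine⁺ (inj₁ (refl , xy)))

  rows-disjoint : ∀ X Y → Disjoint X Y → ∀ u → Disjoint (rows X u) (rows Y u)
  rows-disjoint X Y dsj u x x∈Xu x∈Yu = dsj _ (∈-rows⁻ X x∈Xu) (∈-rows⁻ Y x∈Yu)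

  glue-independent : ∀ R → (∀ u → Independent H (R u)) →
    (∀ u u′ → Adj G u u′ → v ∈ R u → v ∈ R u′ → ⊥) → Independent C (glue R)
  glue-independent R indR noEdge =
    ∀-combine λ u x → ∀-combine λ u′ y ux∈R u′y∈R adj →
      edge (∈-glue⁻ R ux∈R) (∈-glue⁻ R u′y∈R) (Adj-combine⁻ adj)
    where
      edge : ∀ {u u′ x y} → x ∈ R u → y ∈ R u′ → CopyAdj (u , x) (u′ , y) → ⊥
      edge x∈Ru y∈Ru′ (inj₁ (refl , xy))           = indR _ _ _ x∈Ru y∈Ru′ xy
      edge x∈Ru y∈Ru′ (inj₂ ((refl , refl) , uu′)) = noEdge _ _ uu′ x∈Ru y∈Ru′

  glue-maximum : ∀ R → (∀ u → MaximumIndependent H (R u)) → Independent C (glue R) →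
    MaximumIndependent C (glue R)
  glue-maximum R maxR indR = indR , λ Y indY →
    subst (_≤ ∣ glue R ∣) (cong ∣_∣ (glue-rows Y))
      (∣concat∣-mono (rows Y) R λ u → proj₂ (maxR u) (rows Y u) (rows-independent Y indY u))

  W-suc⇒W-concat : ∀ k → W (suc k) H → W k C
  W-suc⇒W-concat k w S indS dsjS = T , max , sub , dsj
    where
      extension : ∀ u → Σ (MaximumExtension H (λ i → rows (S i) u)) λ E →
                          ∀ i → v ∈ MaximumExtension.sets E i → v ∈ rows (S i) u
      extension u = W-suc-extend-fixing H w (λ i → rows (S i) u)
        (λ i → rows-independent (S i) (indS i) u)
        (λ i j i≢j → rows-disjoint (S i) (S j) (dsjS i j i≢j) u) v
      module E u = MaximumExtension (proj₁ (extension u))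

      T : Vector (Subset (order C)) k
      T i = glue λ u → E.sets u i
      ind : ∀ i → Independent C (T i)
      ind i = glue-independent _ (λ u → proj₁ (E.maximum u i)) λ u u′ uu′ v∈Tu v∈Tu′ →
        indS i _ _ (∈-rows⁻ (S i) (proj₂ (extension u) i v∈Tu))
                   (∈-rows⁻ (S i) (proj₂ (extension u′) i v∈Tu′))
                   (Adj-combine⁺ (inj₂ ((refl , refl) , uu′)))
      max : ∀ i → MaximumIndependent C (T i)
      max i = glue-maximum _ (λ u → E.maximum u i) (ind i)
      sub : ∀ i → S i ⊆ T i
      sub i {p} = ∀-combine {P = λ p → p ∈ S i → p ∈ T i}
        (λ u x ux∈Si → ∈-glue⁺ _ (E.extends u i (∈-rows⁺ (S i) ux∈Si))) p
      dsj : PairwiseDisjoint T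
      dsj i j i≢j = ∀-combine λ u x ux∈Ti ux∈Tj →
        E.disjoint u i j i≢j x (∈-glue⁻ _ ux∈Ti) (∈-glue⁻ _ ux∈Tj)

theorem4p11 : (G H : Graph) (v : Fin (order H)) →
    (W 2 H → W 1 (concat G H v)) × (W 3 H → W 2 (concat G H v))
theorem4p11 G H v = W-suc⇒W-concat G H v 1 , W-suc⇒W-concat G H v 2
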